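{- Let $\Gamma'$ be a finite cyclically orientable graph, and let $i,j$ be two non-adjacent vertices of $\Gamma'$ connected by a unique chain $(i=i_1,i_2,\dots,i_t=j)$. Then there exists an orientation of $\Gamma'$ in which every chordless cycle is cyclically oriented and the chain is linearly oriented: $i_1\to i_2\to\cdots\to i_t$.
   Context: Graphs are finite, simple, undirected. A chordless cycle is an induced subgraph isomorphic to a cycle of length at least $3$; under an orientation it is cyclically oriented if its edges form a directed cycle. A graph is cyclically orientable if it admits an orientation in which every chordless cycle is cyclically oriented. A chain connecting non-adjacent vertices $i,j$ is a sequence of $t\ge3$ distinct vertices $(i=i_1,\dots,i_t=j)$ such that the only edges among them are $\{i_p,i_{p+1}\}$ for $p=1,\dots,t-1$. -}

module Defs where

open import Data.Nat using (ℕ; zero; suc; _≤_)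
open import Data.Fin using (Fin; toℕ)
open import Data.Bool using (Bool; true; false)
open import Data.List using (List; length; lookup; head; last)
open import Data.List.Relation.Unary.Unique.Propositional using (Unique)
open import Data.Maybe using (Maybe; just)
open import Data.Product using (Σ; _×_)
open import Data.Sum using (_⊎_)
open import Relation.Binary.PropositionalEquality using (_≡_)

record Graph (n : ℕ) : Set where
  field
    adj    : Fin n → Fin n → Bool
    sym    : ∀ u v → adj u v ≡ adj v u
    irrefl : ∀ u → adj u u ≡ false
open Graph public

IsOrientation : {n : ℕ} → Graph n → (Fin n → Fin n → Bool) → Set
IsOrientation {n} G arc =
  (∀ (u v : Fin n) → adj G u v ≡ true →
       (arc u v ≡ true × arc v u ≡ false) ⊎ (arc u v ≡ false × arc v u ≡ true))
  × (∀ (u v : Fin n) → adj G u v ≡ false → arc u v ≡ false)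

_⟺_ : Set → Set → Set
A ⟺ B = (A → B) × (B → A)

CycSucc : ℕ → ℕ → ℕ → Set
CycSucc k a b = (b ≡ suc a) ⊎ (suc a ≡ k × b ≡ 0)

ChordlessCycle : {n : ℕ} → Graph n → List (Fin n) → Set
ChordlessCycle G c =
  3 ≤ length c × Unique c ×
  (∀ (p q : Fin (length c)) →
     (adj G (lookup c p) (lookup c q) ≡ true)
       ⟺ (CycSucc (length c) (toℕ p) (toℕ q) ⊎ CycSucc (length c) (toℕ q) (toℕ p)))

CyclicallyOriented : {n : ℕ} → (Fin n → Fin n → Bool) → List (Fin n) → Set
CyclicallyOriented arc c =
  (∀ (p q : Fin (length c)) → CycSucc (length c) (toℕ p) (toℕ q) →
       arc (lookup c p) (lookup c q) ≡ true)
  ⊎ (∀ (p q : Fin (length c)) → CycSucc (length c) (toℕ p) (toℕ q) →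
       arc (lookup c q) (lookup c p) ≡ true)

GoodOrientation : {n : ℕ} → Graph n → (Fin n → Fin n → Bool) → Set
GoodOrientation {n} G arc =
  IsOrientation G arc × (∀ (c : List (Fin n)) → ChordlessCycle G c → CyclicallyOriented arc c)

CyclicallyOrientable : {n : ℕ} → Graph n → Set
CyclicallyOrientable G = Σ _ (GoodOrientation G)

IsChain : {n : ℕ} → Graph n → List (Fin n) → Set
IsChain G c =
  3 ≤ length c × Unique c ×
  (∀ (p q : Fin (length c)) →
     (adj G (lookup c p) (lookup c q) ≡ true)
       ⟺ ((toℕ q ≡ suc (toℕ p)) ⊎ (toℕ p ≡ suc (toℕ q))))

ChainBetween : {n : ℕ} → Graph n → Fin n → Fin n → List (Fin n) → Set
ChainBetween G i j c = IsChain G c × head c ≡ just i × last c ≡ just j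

LinearlyOriented : {n : ℕ} → (Fin n → Fin n → Bool) → List (Fin n) → Set
LinearlyOriented arc c =
  ∀ (p q : Fin (length c)) → toℕ q ≡ suc (toℕ p) → arc (lookup c p) (lookup c q) ≡ true

{-# OPTIONS --safe #-}
-- Orient the chain edge by edge, starting at i.  When the edge a → b (a = i_P, b = i_{P+1})
-- points the wrong way, let Y be the component of j in Γ' − a and reverse every edge with an
-- end in Y.  A chordless cycle minus a is connected in Γ' − a, so either all or none of its
-- edges touch Y, and it stays cyclically oriented.  Y contains b, since the chain from b to j
-- avoids a, but none of i_1, …, i_P: otherwise an induced path from i to j in Γ' − a would be
-- a second chain.  So a → b gets reversed while the edges already oriented stay as they are.
module Submission where

open import Defs renaming (sym to adj-sym; irrefl to adj-irrefl)
open import Data.Bool using (Bool; true; false; _∧_; _∨_; not; if_then_else_)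
import Data.Bool as Bool
open import Data.Bool.Properties
  using (∨-comm; ∨-idem; ∨-identityʳ; ∨-zeroʳ; ∧-zeroʳ; ∧-identityʳ; ¬-not)
open import Data.Empty using (⊥-elim)
open import Data.Fin using (Fin; zero; suc; toℕ; fromℕ<; _≟_)
open import Data.Fin.Properties using (toℕ-fromℕ<; toℕ<n; pigeonhole; any?)
import Data.Fin.Properties as Fin
open import Data.List using (List; []; _∷_; length; lookup; last)
open import Data.List.Membership.Propositional using (_∈_)
open import Data.List.Membership.Propositional.Properties using (∈-lookup)
open import Data.List.Relation.Unary.All using (All; []; _∷_)
import Data.List.Relation.Unary.All as All
open import Data.List.Relation.Unary.All.Properties using (¬Any⇒All¬)
open import Data.List.Relation.Unary.Any using (Any; here; there)
import Data.List.Relation.Unary.Any as Any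
open import Data.List.Relation.Unary.AllPairs using ([]; _∷_)
open import Data.List.Relation.Unary.Unique.Propositional using (Unique)
open import Data.Maybe using (just)
open import Data.Nat using (ℕ; zero; suc; _≤_; _<_; z≤n; s≤s; s≤s⁻¹; _≤?_)
open import Data.Nat.Properties
  using (≤-refl; ≤-trans; <-trans; ≤-<-trans; <-≤-trans; <⇒≤; <⇒≢; >⇒≢; ≰⇒>; <-irrefl;
         n<1+n; m<n⇒m<1+n; m≤n⇒m<n∨m≡n; suc-injective; <-cmp; ≤-pred)
open import Data.Product using (Σ; ∃; _×_; _,_; proj₁; proj₂)
open import Data.Sum using (_⊎_; inj₁; inj₂)
import Data.Sum as Sum
open import Function using (_∘_)
open import Relation.Nullary using (¬_; Dec; yes; no; does; contradiction)
open import Relation.Nullary.Decidable using (map′; _×-dec_; _⊎-dec_)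
open import Relation.Binary.Definitions using (tri<; tri≈; tri>)
open import Relation.Binary.PropositionalEquality
  using (_≡_; _≢_; refl; sym; trans; cong; cong₂; subst; subst₂; module ≡-Reasoning)

private
  variable
    A : Set
    n : ℕ

-- Past the end of the list the junk value d is returned.
nth : A → List A → ℕ → A
nth d []       _       = d
nth d (x ∷ xs) zero    = x
nth d (x ∷ xs) (suc r) = nth d xs r

module _ {d : A} where

  nth-lookup : ∀ l (p : Fin (length l)) → nth d l (toℕ p) ≡ lookup l p
  nth-lookup (x ∷ xs) zero    = refl
  nth-lookup (x ∷ xs) (suc p) = nth-lookup xs p

  nth-fromℕ< : ∀ l {r} (r<l : r < length l) → nth d l r ≡ lookup l (fromℕ< r<l)
  nth-fromℕ< l r<l = trans (cong (nth d l) (sym (toℕ-fromℕ< r<l))) (nth-lookup l (fromℕ< r<l))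

  nth-∈ : ∀ l {r} → r < length l → nth d l r ∈ l
  nth-∈ l r<l = subst (_∈ l) (sym (nth-fromℕ< l r<l)) (∈-lookup (fromℕ< r<l))

  nth-last : ∀ {x y} xs → last (x ∷ xs) ≡ just y → nth d (x ∷ xs) (length xs) ≡ y
  nth-last []       refl = refl
  nth-last (x ∷ xs) eq   = nth-last xs eq

lookup-injective : ∀ {l : List A} {p q} → Unique l → lookup l p ≡ lookup l q → p ≡ q
lookup-injective {l = x ∷ xs} {zero}  {zero}  _          _  = refl
lookup-injective {l = x ∷ xs} {zero}  {suc q} (x∉ ∷ _)   eq = ⊥-elim (All.lookup x∉ (∈-lookup q) eq)
lookup-injective {l = x ∷ xs} {suc p} {zero}  (x∉ ∷ _)   eq = ⊥-elim (All.lookup x∉ (∈-lookup p) (sym eq))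
lookup-injective {l = x ∷ xs} {suc p} {suc q} (_ ∷ uniq) eq = cong suc (lookup-injective uniq eq)

nth-injective : ∀ {d : A} {l r s} → Unique l → r < length l → s < length l →
                nth d l r ≡ nth d l s → r ≡ s
nth-injective {l = l} {r} {s} uniq r<l s<l eq = begin
  r                    ≡⟨ toℕ-fromℕ< r<l ⟨
  toℕ (fromℕ< r<l)     ≡⟨ cong toℕ (lookup-injective uniq lookups) ⟩
  toℕ (fromℕ< s<l)     ≡⟨ toℕ-fromℕ< s<l ⟩
  s                    ∎
  where
  open ≡-Reasoning
  lookups : lookup l (fromℕ< r<l) ≡ lookup l (fromℕ< s<l)
  lookups = trans (sym (nth-fromℕ< l r<l)) (trans eq (nth-fromℕ< l s<l))

unique-length : {l : List (Fin n)} → Unique l → length l ≤ n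
unique-length {n} {l} uniq with length l ≤? n
... | yes l≤n = l≤n
... | no l≰n with pigeonhole (≰⇒> l≰n) (lookup l)
...   | p , q , p<q , eq = contradiction (lookup-injective uniq eq) (Fin.<⇒≢ p<q)

module _ (g : ℕ → A) where

  constant-between : ∀ {r s} → r ≤ s → (∀ {t} → r ≤ t → t < s → g t ≡ g (suc t)) → g r ≡ g s
  constant-between {s = zero}  z≤n _ = refl
  constant-between {r} {suc s} r≤1+s moves with m≤n⇒m<n∨m≡n r≤1+s
  ... | inj₂ refl  = refl
  ... | inj₁ r<1+s = trans (constant-between r≤s (λ r≤t t<s → moves r≤t (m<n⇒m<1+n t<s)))
                           (moves r≤s ≤-refl)
    where
    r≤s : r ≤ s
    r≤s = s≤s⁻¹ r<1+s

  module _ (K m : ℕ) (moves : ∀ {t} → t < K → t ≢ m → suc t ≢ m → g t ≡ g (suc t)) where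

    constant-before : ∀ {r} → r < m → r ≤ K → g 0 ≡ g r
    constant-before r<m r≤K = constant-between z≤n λ _ t<r →
      moves (<-≤-trans t<r r≤K) (<⇒≢ (<-trans t<r r<m)) (<⇒≢ (≤-<-trans t<r r<m))

    constant-after : ∀ {r} → m < r → r ≤ K → g r ≡ g K
    constant-after m<r r≤K = constant-between r≤K λ r≤t t<K →
      moves t<K (>⇒≢ (<-≤-trans m<r r≤t)) (>⇒≢ (m<n⇒m<1+n (<-≤-trans m<r r≤t)))

    module _ (wrap : K ≢ m → 0 ≢ m → g K ≡ g 0) where

      constant-across : ∀ {r s} → r < m → m < s → s ≤ K → g r ≡ g s
      constant-across {r} {s} r<m m<s s≤K = begin
        g r  ≡⟨ constant-before r<m (<⇒≤ (<-≤-trans r<m (<⇒≤ m<K))) ⟨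
        g 0  ≡⟨ wrap (>⇒≢ m<K) (<⇒≢ (≤-<-trans z≤n r<m)) ⟨
        g K  ≡⟨ constant-after m<s s≤K ⟨
        g s  ∎
        where
        open ≡-Reasoning
        m<K : m < K
        m<K = <-≤-trans m<s s≤K

      cyclic-constant : ∀ {r s} → r ≤ K → s ≤ K → r ≢ m → s ≢ m → g r ≡ g s
      cyclic-constant {r} {s} r≤K s≤K r≢m s≢m with <-cmp r m | <-cmp s m
      ... | tri≈ _ r≡m _ | _            = contradiction r≡m r≢m
      ... | _            | tri≈ _ s≡m _ = contradiction s≡m s≢m
      ... | tri< r<m _ _ | tri< s<m _ _ = trans (sym (constant-before r<m r≤K)) (constant-before s<m s≤K)
      ... | tri> _ _ m<r | tri> _ _ m<s = trans (constant-after m<r r≤K) (sym (constant-after m<s s≤K))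
      ... | tri< r<m _ _ | tri> _ _ m<s = constant-across r<m m<s s≤K
      ... | tri> _ _ m<r | tri< s<m _ _ = sym (constant-across s<m m<r r≤K)

module _ {n : ℕ} (G : Graph n) where

  Related : Fin n → Fin n → Set
  Related x w = x ≡ w ⊎ adj G x w ≡ true

  related? : ∀ x w → Dec (Related x w)
  related? x w = x ≟ w ⊎-dec adj G x w Bool.≟ true

  data InducedPath : Fin n → Fin n → List (Fin n) → Set where
    single : ∀ {z} → InducedPath z z (z ∷ [])
    link   : ∀ {x y z ys} → adj G x y ≡ true → All (¬_ ∘ Related x) ys →
             InducedPath y z (y ∷ ys) → InducedPath x z (x ∷ y ∷ ys)

module _ {n : ℕ} {G : Graph n} where

  adj⇒≢ : ∀ {u v} → adj G u v ≡ true → u ≢ v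
  adj⇒≢ {u} uv refl = contradiction (trans (sym (adj-irrefl G u)) uv) λ ()

  -- x is joined to the last vertex of the path it is related to; the vertices before it are dropped.
  shortcut : ∀ {x y z ys} → Any (Related G x) (y ∷ ys) → InducedPath G y z (y ∷ ys) →
             ∃ λ xs → InducedPath G x z (x ∷ xs)
  shortcut (here (inj₁ refl)) single = _ , single
  shortcut (here (inj₂ xz))   single = _ , link xz [] single
  shortcut {x} {ys = ys} x~ path@(link _ _ tail) with Any.any? (related? G x) ys
  ... | yes x~ys = shortcut x~ys tail
  ... | no x≁ys with x~
  ...   | here (inj₁ refl) = _ , path
  ...   | here (inj₂ xy)   = _ , link xy (¬Any⇒All¬ ys x≁ys) path
  ...   | there x~ys       = contradiction x~ys x≁ys

  induced-unique : ∀ {x z l} → InducedPath G x z l → Unique l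
  induced-unique single            = [] ∷ []
  induced-unique (link xy x≁ path) = (adj⇒≢ xy ∷ All.map (_∘ inj₁) x≁) ∷ induced-unique path

  induced-last : ∀ {x z l} → InducedPath G x z l → last l ≡ just z
  induced-last single           = refl
  induced-last (link _ _ path) = induced-last path

  private
    Consecutive : ℕ → ℕ → Set
    Consecutive r s = s ≡ suc r ⊎ r ≡ suc s

    first-adj⟺ : ∀ {x z xs} → InducedPath G x z (x ∷ xs) → ∀ q →
                 (adj G x (lookup (x ∷ xs) q) ≡ true) ⟺ Consecutive 0 (toℕ q)
    first-adj⟺ path zero = (λ xx → contradiction refl (adj⇒≢ xx)) , λ { (inj₁ ()) ; (inj₂ ()) }
    first-adj⟺ (link xy _ _) (suc zero)    = (λ _ → inj₁ refl) , λ _ → xy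
    first-adj⟺ (link _ x≁ _) (suc (suc q)) =
      (λ xw → contradiction (inj₂ xw) (All.lookup x≁ (∈-lookup q))) , λ { (inj₁ ()) ; (inj₂ ()) }

  induced-adj⟺ : ∀ {x z l} → InducedPath G x z l → ∀ p q →
                 (adj G (lookup l p) (lookup l q) ≡ true) ⟺ Consecutive (toℕ p) (toℕ q)
  induced-adj⟺ single                zero    zero = first-adj⟺ single zero
  induced-adj⟺ path@(link _ _ _)     zero    q    = first-adj⟺ path q
  induced-adj⟺ path@(link _ _ _)     (suc p) zero with first-adj⟺ path (suc p)
  ... | to , from = (λ e → Sum.swap (to (trans (adj-sym G _ _) e))) ,
                    (λ c → trans (adj-sym G _ _) (from (Sum.swap c)))
  induced-adj⟺ (link _ _ path) (suc p) (suc q) with induced-adj⟺ path p q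
  ... | to , from = Sum.map (cong suc) (cong suc) ∘ to ,
                    from ∘ Sum.map suc-injective suc-injective

  induced⇒chain : ∀ {x z l} → x ≢ z → adj G x z ≡ false → InducedPath G x z l → ChainBetween G x z l
  induced⇒chain x≢z _   single                       = contradiction refl x≢z
  induced⇒chain _   x≁z (link xz _ single)           = contradiction (trans (sym xz) x≁z) λ ()
  induced⇒chain _   _   path@(link _ _ (link _ _ _)) =
    (s≤s (s≤s (s≤s z≤n)) , induced-unique path , induced-adj⟺ path) , refl , induced-last path

module _ {n : ℕ} (H : Graph n) (z : Fin n) where

  data Reach : ℕ → Fin n → Set where
    arrived : ∀ {k} → Reach k z
    via     : ∀ {k u v} → adj H u v ≡ true → Reach k v → Reach (suc k) u

  reach? : ∀ k u → Dec (Reach k u)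
  reach? zero    u = map′ (λ { refl → arrived }) (λ { arrived → refl }) (u ≟ z)
  reach? (suc k) u =
    map′ (λ { (inj₁ refl) → arrived ; (inj₂ (v , uv , r)) → via uv r })
         (λ { arrived → inj₁ refl ; (via uv r) → inj₂ (_ , uv , r) })
         (u ≟ z ⊎-dec any? (λ v → adj H u v Bool.≟ true ×-dec reach? k v))

  reach-mono : ∀ {k k′ u} → k ≤ k′ → Reach k u → Reach k′ u
  reach-mono _          arrived    = arrived
  reach-mono (s≤s k≤k′) (via uv r) = via uv (reach-mono k≤k′ r)

  reach⇒induced : ∀ {k u} → Reach k u → ∃ λ us → InducedPath H u z (u ∷ us)
  reach⇒induced arrived    = _ , single
  reach⇒induced (via uv r) = shortcut (here (inj₂ uv)) (proj₂ (reach⇒induced r))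

  induced⇒reach : ∀ {u l} → InducedPath H u z l → Reach (length l) u
  induced⇒reach single           = arrived
  induced⇒reach (link uv _ path) = via uv (induced⇒reach path)

  -- An induced path is repetition-free, so n steps always suffice.
  reach-within : ∀ {k u} → Reach k u → Reach n u
  reach-within r with reach⇒induced r
  ... | _ , path = reach-mono (unique-length (induced-unique path)) (induced⇒reach path)

  reachable : Fin n → Bool
  reachable u = does (reach? n u)

  reachable-target : reachable z ≡ true
  reachable-target with reach? n z
  ... | yes _ = refl
  ... | no ¬r = contradiction arrived ¬r

  reachable-adj : ∀ {u v} → adj H u v ≡ true → reachable u ≡ reachable v
  reachable-adj {u} {v} uv with reach? n u | reach? n v
  ... | yes _  | yes _  = refl
  ... | no _   | no _   = refl
  ... | yes ru | no ¬rv = contradiction (reach-within (via (trans (adj-sym H v u) uv) ru)) ¬rv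
  ... | no ¬ru | yes rv = contradiction (reach-within (via uv rv)) ¬ru

  reachable⇒induced : ∀ {u} → reachable u ≡ true → ∃ λ us → InducedPath H u z (u ∷ us)
  reachable⇒induced {u} r with reach? n u
  ... | yes ru = reach⇒induced ru

-- G ∖ a keeps the vertex a but deletes every edge at it.
_∖_ : Graph n → Fin n → Graph n
G ∖ a = record
  { adj    = λ u v → adj G u v ∧ not (does (u ≟ a) ∨ does (v ≟ a))
  ; sym    = λ u v → cong₂ (λ e d → e ∧ not d) (adj-sym G u v) (∨-comm (does (u ≟ a)) _)
  ; irrefl = λ u → cong (_∧ _) (adj-irrefl G u)
  }

module _ {n : ℕ} {G : Graph n} {a : Fin n} where

  ∖-adj : ∀ {u v} → u ≢ a → v ≢ a → adj (G ∖ a) u v ≡ adj G u v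
  ∖-adj {u} {v} u≢a v≢a with u ≟ a | v ≟ a
  ... | yes u≡a | _       = contradiction u≡a u≢a
  ... | no _    | yes v≡a = contradiction v≡a v≢a
  ... | no _    | no _    = ∧-identityʳ (adj G u v)

  ∖-adj⇒≢ : ∀ {u v} → adj (G ∖ a) u v ≡ true → u ≢ a
  ∖-adj⇒≢ {u} {v} uv u≡a with u ≟ a
  ... | yes _   = contradiction (trans (sym uv) (∧-zeroʳ (adj G u v))) λ ()
  ... | no u≢a  = u≢a u≡a

  ∖-adj⇒adj : ∀ {u v} → adj (G ∖ a) u v ≡ true → adj G u v ≡ true
  ∖-adj⇒adj {u} {v} uv =
    trans (sym (∖-adj (∖-adj⇒≢ uv) (∖-adj⇒≢ (trans (adj-sym (G ∖ a) v u) uv)))) uv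

  lift-induced : ∀ {u z l} → z ≢ a → InducedPath (G ∖ a) u z l → InducedPath G u z l × All (_≢ a) l
  lift-induced z≢a single = single , z≢a ∷ []
  lift-induced z≢a (link {x} xy x≁ path) with lift-induced z≢a path
  ... | path′ , avoids@(_ ∷ ys≢a) =
    link (∖-adj⇒adj xy) (All.zipWith unrelated (x≁ , ys≢a)) path′ , x≢a ∷ avoids
    where
    x≢a : x ≢ a
    x≢a = ∖-adj⇒≢ xy
    unrelated : ∀ {w} → ¬ Related (G ∖ a) x w × w ≢ a → ¬ Related G x w
    unrelated (x≁w , _)   (inj₁ x≡w) = x≁w (inj₁ x≡w)
    unrelated (x≁w , w≢a) (inj₂ xw)  = x≁w (inj₂ (trans (∖-adj x≢a w≢a) xw))

component : Graph n → Fin n → Fin n → Fin n → Bool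
component G a z = reachable (G ∖ a) z

module _ {n : ℕ} {G : Graph n} {a z : Fin n} where

  component-target : component G a z z ≡ true
  component-target = reachable-target (G ∖ a) z

  component-deleted : z ≢ a → component G a z a ≡ false
  component-deleted z≢a = ¬-not λ a∈C → isolated (reachable⇒induced (G ∖ a) z a∈C)
    where
    isolated : ¬ ∃ λ us → InducedPath (G ∖ a) a z (a ∷ us)
    isolated (_ , single)      = z≢a refl
    isolated (_ , link au _ _) = ∖-adj⇒≢ {G = G} au refl

  component-adj : ∀ {u v} → u ≢ a → v ≢ a → adj G u v ≡ true →
                  component G a z u ≡ component G a z v
  component-adj u≢a v≢a uv = reachable-adj (G ∖ a) z (trans (∖-adj {G = G} u≢a v≢a) uv)

  component-path : ∀ {u} → z ≢ a → component G a z u ≡ true →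
                   ∃ λ l → InducedPath G u z l × All (_≢ a) l
  component-path z≢a u∈C = _ , lift-induced z≢a (proj₂ (reachable⇒induced (G ∖ a) z u∈C))

reverse-arc : ∀ {G : Graph n} {arc} → IsOrientation G arc →
              ∀ {u v} → adj G u v ≡ true → arc u v ≡ false → arc v u ≡ true
reverse-arc (oriented , _) {u} {v} uv ¬uv with oriented u v uv
... | inj₁ (uv→ , _) = contradiction (trans (sym uv→) ¬uv) λ ()
... | inj₂ (_ , vu→) = vu→

reverseTouching : (Fin n → Bool) → (Fin n → Fin n → Bool) → Fin n → Fin n → Bool
reverseTouching S arc u v = if S u ∨ S v then arc v u else arc u v

UniformlyTouched : (Fin n → Bool) → List (Fin n) → Set
UniformlyTouched S cc =
  ∃ λ β → ∀ p q → CycSucc (length cc) (toℕ p) (toℕ q) → S (lookup cc p) ∨ S (lookup cc q) ≡ β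

module _ {n : ℕ} {S : Fin n → Bool} {arc : Fin n → Fin n → Bool} where

  reverseTouching-at : ∀ {u v β} → S u ∨ S v ≡ β →
                       reverseTouching S arc u v ≡ (if β then arc v u else arc u v)
  reverseTouching-at refl = refl

  reverseTouching-at′ : ∀ {u v β} → S v ∨ S u ≡ β →
                        reverseTouching S arc u v ≡ (if β then arc v u else arc u v)
  reverseTouching-at′ {u} {v} vu = reverseTouching-at (trans (∨-comm (S u) (S v)) vu)

  reverseTouching-cyclic : ∀ {cc} → UniformlyTouched S cc → CyclicallyOriented arc cc →
                           CyclicallyOriented (reverseTouching S arc) cc
  reverseTouching-cyclic (false , touched) (inj₁ forward) =
    inj₁ λ p q pq → trans (reverseTouching-at (touched p q pq)) (forward p q pq)
  reverseTouching-cyclic (false , touched) (inj₂ backward) =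
    inj₂ λ p q pq → trans (reverseTouching-at′ (touched p q pq)) (backward p q pq)
  reverseTouching-cyclic (true , touched) (inj₁ forward) =
    inj₂ λ p q pq → trans (reverseTouching-at′ (touched p q pq)) (forward p q pq)
  reverseTouching-cyclic (true , touched) (inj₂ backward) =
    inj₁ λ p q pq → trans (reverseTouching-at (touched p q pq)) (backward p q pq)

module _ {n : ℕ} {G : Graph n} {S : Fin n → Bool} {arc : Fin n → Fin n → Bool} where

  reverseTouching-orientation : IsOrientation G arc → IsOrientation G (reverseTouching S arc)
  reverseTouching-orientation (oriented , unoriented) = oriented′ , unoriented′
    where
    oriented′ : ∀ u v → adj G u v ≡ true →
      (reverseTouching S arc u v ≡ true × reverseTouching S arc v u ≡ false) ⊎
      (reverseTouching S arc u v ≡ false × reverseTouching S arc v u ≡ true)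
    oriented′ u v uv rewrite ∨-comm (S v) (S u) with S u ∨ S v
    ... | true  = oriented v u (trans (adj-sym G v u) uv)
    ... | false = oriented u v uv
    unoriented′ : ∀ u v → adj G u v ≡ false → reverseTouching S arc u v ≡ false
    unoriented′ u v uv with S u ∨ S v
    ... | true  = unoriented v u (trans (adj-sym G v u) uv)
    ... | false = unoriented u v uv

  reverseTouching-good : (∀ {cc} → ChordlessCycle G cc → UniformlyTouched S cc) →
                         GoodOrientation G arc → GoodOrientation G (reverseTouching S arc)
  reverseTouching-good uniform (orientation , cyclic) =
    reverseTouching-orientation orientation ,
    λ cc chordless → reverseTouching-cyclic {S = S} {arc} {cc} (uniform chordless) (cyclic cc chordless)

-- m = length l when x does not occur in l.
position : ∀ {d} (x : Fin n) (l : List (Fin n)) → Unique l →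
           Σ ℕ λ m → ∀ {t} → t < length l → (nth d l t ≡ x) ⟺ (t ≡ m)
position x l uniq with any? (λ p → lookup l p ≟ x)
... | yes (p , p↦x) = toℕ p , λ t<l →
  (λ t↦x → nth-injective uniq t<l (toℕ<n p) (trans t↦x (sym (trans (nth-lookup l p) p↦x)))) ,
  (λ { refl → trans (nth-lookup l p) p↦x })
... | no x∉l = length l , λ t<l →
  (λ t↦x → contradiction (fromℕ< t<l , trans (sym (nth-fromℕ< l t<l)) t↦x) x∉l) ,
  (λ { refl → contradiction t<l (<-irrefl refl) })

adjacent-positions : ∀ {G : Graph n} {d l} (R : ℕ → ℕ → Set) →
  (∀ p q → R (toℕ p) (toℕ q) → adj G (lookup l p) (lookup l q) ≡ true) →
  ∀ {r s} → r < length l → s < length l → R r s → adj G (nth d l r) (nth d l s) ≡ true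
adjacent-positions {G = G} {l = l} R adjacent r<l s<l rs =
  subst₂ (λ u v → adj G u v ≡ true) (sym (nth-fromℕ< l r<l)) (sym (nth-fromℕ< l s<l))
    (adjacent (fromℕ< r<l) (fromℕ< s<l) (subst₂ R (sym (toℕ-fromℕ< r<l)) (sym (toℕ-fromℕ< s<l)) rs))

cycle-vertex-≢ : ∀ {G : Graph n} {cc} a → ChordlessCycle G cc → ∃ λ p → lookup cc p ≢ a
cycle-vertex-≢ {cc = []}        _ (() , _)
cycle-vertex-≢ {cc = _ ∷ []}    _ (s≤s () , _)
cycle-vertex-≢ {cc = x ∷ _ ∷ _} a (_ , (x≢y ∷ _) ∷ _ , _) with x ≟ a
... | yes refl = suc zero , x≢y ∘ sym
... | no x≢a   = zero , x≢a

module _ {n : ℕ} {G : Graph n} {S : Fin n → Bool} {a : Fin n} (S-a : S a ≡ false)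
         (S-adj : ∀ {u v} → u ≢ a → v ≢ a → adj G u v ≡ true → S u ≡ S v) where

  edge-touches : ∀ {u v β} → u ≢ v → (u ≢ a → S u ≡ β) → (v ≢ a → S v ≡ β) → S u ∨ S v ≡ β
  edge-touches {u} {v} u≢v u↦β v↦β with u ≟ a | v ≟ a
  ... | yes refl | yes refl = contradiction refl u≢v
  ... | yes refl | no v≢a  = trans (cong (_∨ S v) S-a) (v↦β v≢a)
  ... | no u≢a  | yes refl = trans (cong (S u ∨_) S-a) (trans (∨-identityʳ (S u)) (u↦β u≢a))
  ... | no u≢a  | no v≢a  = trans (cong₂ _∨_ (u↦β u≢a) (v↦β v≢a)) (∨-idem _)

  -- Deleting a from a chordless cycle leaves a path, and that path lies in G ∖ a.
  cycle-constant : ∀ {cc} → ChordlessCycle G cc → ∀ {p q} → lookup cc p ≢ a → lookup cc q ≢ a →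
                   S (lookup cc p) ≡ S (lookup cc q)
  cycle-constant {[]} (() , _)
  cycle-constant {cc@(x ∷ xs)} (_ , uniq , adj⟺) {p} {q} p≢a q≢a with position {d = x} a cc uniq
  ... | m , at-m = begin
    S (lookup cc p)       ≡⟨ cong S (nth-lookup cc p) ⟨
    g (toℕ p)             ≡⟨ cyclic-constant g K m forward wrap (≤-pred (toℕ<n p)) (≤-pred (toℕ<n q))
                                                               (off-a p p≢a) (off-a q q≢a) ⟩
    g (toℕ q)             ≡⟨ cong S (nth-lookup cc q) ⟩
    S (lookup cc q)       ∎
    where
    open ≡-Reasoning
    K : ℕ
    K = length xs
    g : ℕ → Bool
    g = S ∘ nth x cc
    off-a : ∀ p → lookup cc p ≢ a → toℕ p ≢ m
    off-a p p≢a t≡m = p≢a (trans (sym (nth-lookup cc p)) (proj₂ (at-m (toℕ<n p)) t≡m))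
    along : ∀ {r s} → r < length cc → s < length cc → r ≢ m → s ≢ m →
            CycSucc (length cc) r s → g r ≡ g s
    along r<l s<l r≢m s≢m rs = S-adj (r≢m ∘ proj₁ (at-m r<l)) (s≢m ∘ proj₁ (at-m s<l))
      (adjacent-positions {G = G} {d = x} {l = cc} (CycSucc (length cc))
                          (λ p q pq → proj₂ (adj⟺ p q) (inj₁ pq)) r<l s<l rs)
    forward : ∀ {t} → t < K → t ≢ m → suc t ≢ m → g t ≡ g (suc t)
    forward t<K t≢m 1+t≢m = along (m<n⇒m<1+n t<K) (s≤s t<K) t≢m 1+t≢m (inj₁ refl)
    wrap : K ≢ m → 0 ≢ m → g K ≡ g 0
    wrap K≢m 0≢m = along (n<1+n K) (s≤s z≤n) K≢m 0≢m (inj₂ (refl , refl))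

  cycle-uniform : ∀ {cc} → ChordlessCycle G cc → UniformlyTouched S cc
  cycle-uniform {cc} cycle@(_ , _ , adj⟺) with cycle-vertex-≢ {G = G} a cycle
  ... | p₀ , p₀≢a = S (lookup cc p₀) , λ p q pq →
    edge-touches (adj⇒≢ {G = G} (proj₂ (adj⟺ p q) (inj₁ pq)))
                 (λ p≢a → cycle-constant cycle p≢a p₀≢a) (λ q≢a → cycle-constant cycle q≢a p₀≢a)

module Orienting {n : ℕ} {G : Graph n} (orientable : CyclicallyOrientable G)
                 {i j : Fin n} (i≁j : adj G i j ≡ false) {cs : List (Fin n)}
                 (chain : ChainBetween G i j (i ∷ cs))
                 (only-chain : ∀ c′ → ChainBetween G i j c′ → c′ ≡ i ∷ cs) where

  c : List (Fin n)
  c = i ∷ cs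

  L : ℕ
  L = length cs

  vertex : ℕ → Fin n
  vertex = nth i c

  private
    3≤length : 3 ≤ length c
    3≤length = proj₁ (proj₁ chain)

    c-unique : Unique c
    c-unique = proj₁ (proj₂ (proj₁ chain))

    c-adj⟺ : ∀ p q → (adj G (lookup c p) (lookup c q) ≡ true) ⟺
                     ((toℕ q ≡ suc (toℕ p)) ⊎ (toℕ p ≡ suc (toℕ q)))
    c-adj⟺ = proj₂ (proj₂ (proj₁ chain))

    c-last : last c ≡ just j
    c-last = proj₂ (proj₂ chain)

  vertex-injective : ∀ {r s} → r ≤ L → s ≤ L → vertex r ≡ vertex s → r ≡ s
  vertex-injective r≤L s≤L = nth-injective c-unique (s≤s r≤L) (s≤s s≤L)

  vertex-adj : ∀ {r} → r < L → adj G (vertex r) (vertex (suc r)) ≡ true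
  vertex-adj r<L = adjacent-positions {G = G} {d = i} {l = c} (λ r s → s ≡ suc r)
    (λ p q → proj₂ (c-adj⟺ p q) ∘ inj₁) (m<n⇒m<1+n r<L) (s≤s r<L) refl

  vertex-last : vertex L ≡ j
  vertex-last = nth-last cs c-last

  i≢j : i ≢ j
  i≢j i≡j = <⇒≢ (≤-trans (s≤s z≤n) (s≤s⁻¹ 3≤length))
                (vertex-injective z≤n ≤-refl (trans i≡j (sym vertex-last)))

  -- If i were in the component, an induced path from i to j in G ∖ a would be a second chain,
  -- one avoiding a.
  i-outside-component : ∀ {a} → a ∈ c → j ≢ a → component G a j i ≡ false
  i-outside-component {a} a∈c j≢a = ¬-not λ i∈C →
    let l , path , avoids = component-path j≢a i∈C
        l≡c = only-chain l (induced⇒chain i≢j i≁j path)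
    in  All.lookup avoids (subst (a ∈_) (sym l≡c) a∈c) refl

  OrientedUpTo : ℕ → (Fin n → Fin n → Bool) → Set
  OrientedUpTo P arc = ∀ {r} → r < P → arc (vertex r) (vertex (suc r)) ≡ true

  GoodUpTo : ℕ → Set
  GoodUpTo P = Σ _ λ arc → GoodOrientation G arc × OrientedUpTo P arc

  oriented-extend : ∀ {P arc} → OrientedUpTo P arc → arc (vertex P) (vertex (suc P)) ≡ true →
                    OrientedUpTo (suc P) arc
  oriented-extend before now r<1+P with m≤n⇒m<n∨m≡n (s≤s⁻¹ r<1+P)
  ... | inj₁ r<P  = before r<P
  ... | inj₂ refl = now

  module _ {P} (P<L : P < L) where

    private
      a : Fin n
      a = vertex P

      Y : Fin n → Bool
      Y = component G a j

    j≢a : j ≢ a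
    j≢a j≡a = <⇒≢ P<L (vertex-injective (<⇒≤ P<L) ≤-refl (trans (sym j≡a) (sym vertex-last)))

    Y-deleted : Y a ≡ false
    Y-deleted = component-deleted {G = G} j≢a

    Y-adj : ∀ {u v} → u ≢ a → v ≢ a → adj G u v ≡ true → Y u ≡ Y v
    Y-adj = component-adj {G = G}

    Y-moves : ∀ {t} → t < L → t ≢ P → suc t ≢ P → Y (vertex t) ≡ Y (vertex (suc t))
    Y-moves t<L t≢P 1+t≢P = Y-adj (t≢P ∘ vertex-injective (<⇒≤ t<L) (<⇒≤ P<L))
                                  (1+t≢P ∘ vertex-injective t<L (<⇒≤ P<L))
                                  (vertex-adj t<L)

    Y-prefix : ∀ {r} → r ≤ P → Y (vertex r) ≡ false
    Y-prefix r≤P with m≤n⇒m<n∨m≡n r≤P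
    ... | inj₂ refl = Y-deleted
    ... | inj₁ r<P  = trans (sym (constant-between (Y ∘ vertex) z≤n λ _ t<r →
                              Y-moves (<-trans (<-trans t<r r<P) P<L) (<⇒≢ (<-trans t<r r<P))
                                      (<⇒≢ (≤-<-trans t<r r<P))))
                            (i-outside-component (nth-∈ c (m<n⇒m<1+n P<L)) j≢a)

    Y-next : Y (vertex (suc P)) ≡ true
    Y-next = trans (constant-between (Y ∘ vertex) P<L λ P<t t<L →
                      Y-moves t<L (>⇒≢ P<t) (>⇒≢ (m<n⇒m<1+n P<t)))
                   (trans (cong Y vertex-last) (component-target {G = G}))

    orient-next : GoodUpTo P → GoodUpTo (suc P)
    orient-next (arc , good , before) with arc (vertex P) (vertex (suc P)) in ab
    ... | true  = arc , good , oriented-extend {arc = arc} before ab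
    ... | false = reverseTouching Y arc , good′ ,
                  oriented-extend {arc = reverseTouching Y arc} before′ now
      where
      good′ : GoodOrientation G (reverseTouching Y arc)
      good′ = reverseTouching-good {G = G} {S = Y} {arc = arc}
                (cycle-uniform {G = G} {S = Y} Y-deleted Y-adj) good
      before′ : OrientedUpTo P (reverseTouching Y arc)
      before′ r<P = trans (reverseTouching-at {S = Y} {arc = arc}
                            (cong₂ _∨_ (Y-prefix (<⇒≤ r<P)) (Y-prefix r<P)))
                          (before r<P)
      now : reverseTouching Y arc (vertex P) (vertex (suc P)) ≡ true
      now = trans (reverseTouching-at {S = Y} {arc = arc}
                    (trans (cong (Y a ∨_) Y-next) (∨-zeroʳ (Y a))))
                  (reverse-arc {G = G} (proj₁ good) (vertex-adj P<L) ab)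

  orient-prefix : ∀ {P} → P ≤ L → GoodUpTo P
  orient-prefix {zero}  _   = proj₁ orientable , proj₂ orientable , λ ()
  orient-prefix {suc P} P<L = orient-next P<L (orient-prefix (<⇒≤ P<L))

  linearly-oriented : ∀ {arc} → OrientedUpTo L arc → LinearlyOriented arc c
  linearly-oriented {arc} oriented p q q≡1+p =
    subst₂ (λ u v → arc u v ≡ true)
           (nth-lookup c p) (trans (cong vertex (sym q≡1+p)) (nth-lookup c q))
           (oriented (s≤s⁻¹ (subst (_< suc L) q≡1+p (toℕ<n q))))

lemma5p4 : {n : ℕ} (G : Graph n) → CyclicallyOrientable G →
    (i j : Fin n) → adj G i j ≡ false →
    (c : List (Fin n)) → ChainBetween G i j c →
    (∀ (c′ : List (Fin n)) → ChainBetween G i j c′ → c′ ≡ c) →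
    Σ (Fin n → Fin n → Bool) (λ arc → GoodOrientation G arc × LinearlyOriented arc c)
lemma5p4 G orientable i j i≁j []       ((() , _) , _) _
lemma5p4 G orientable i j i≁j (_ ∷ cs) chain@(_ , refl , _) only-chain =
  let arc , good , oriented = orient-prefix (≤-refl {L})
  in  arc , good , linearly-oriented {arc} oriented
  where open Orienting {G = G} orientable i≁j chain only-chain
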